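{- Let $\mathbf C$ be a double-suited IFG-algebra (of some dimension $N$ over some base set $A$) and suppose there is a binary term $T(X,Y)$ in the language of IFG$_N$-algebras such that for all elements $X,Y$ of $\mathbf C$, $T^{\mathbf C}(X,Y)=1$ if and only if $X=Y$. Then $\mathbf C$ is hereditarily simple.
   Context: Identify $N$ with $\{0,\dots,N-1\}$; ${}^NA$ is the set of valuations $\vec a=(a_0,\dots,a_{N-1})$; a team is a subset of ${}^NA$. For $J\subseteq N$, $\vec a\approx_J\vec b$ means they agree on $N\setminus J$. $V=V_1\cup_J V_2$ means $V_1\cup V_2=V$, $V_1\cap V_2=\emptyset$, and each $V_i$ is closed under $\approx_J$ within $V$. $f:V\to A$ is independent of $J$ if $f(\vec a)=f(\vec b)$ whenever $\vec a\approx_J\vec b$. $\vec a(n:b)$ is $\vec a$ with $n$th coordinate replaced by $b$; $V(n:f)=\{\vec a(n:f(\vec a)):\vec a\in V\}$; $W(n:A)=\{\vec a(n:b):\vec a\in W,b\in A\}$. The IFG-cylindric power set algebra with base set $A$ and dimension $N$ has universe $\mathcal P(\mathcal P({}^NA))\times\mathcal P(\mathcal P({}^NA))$, elements written $X=\langle X^+,X^-\rangle$, and the operations (the language of IFG$_N$-algebras): constants $0=\langle\{\emptyset\},\mathcal P({}^NA)\rangle$, $1=\langle\mathcal P({}^NA),\{\emptyset\}\rangle$, $D_{ij}=\langle\mathcal P(\{\vec a:a_i=a_j\}),\mathcal P(\{\vec a:a_i\neq a_j\})\rangle$ ($i,j<N$); $\neg X=\langle X^-,X^+\rangle$; for $J\subseteq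 N$: $(X+_JY)^+=\{V:V=V_1\cup_JV_2,\ V_1\in X^+,V_2\in Y^+\}$, $(X+_JY)^-=X^-\cap Y^-$; $(X\cdot_JY)^+=X^+\cap Y^+$, $(X\cdot_JY)^-=\{W:W=W_1\cup_JW_2,\ W_1\in X^-,W_2\in Y^-\}$; for $n<N$, $J\subseteq N$: $C_{n,J}(X)^+=\{V:V(n:f)\in X^+$ for some $f:V\to A$ independent of $J\}$, $C_{n,J}(X)^-=\{W:W(n:A)\in X^-\}$. An IFG$_N$-algebra (IFG-algebra of dimension $N$) is a subalgebra of such an algebra. A suit is a nonempty set $S\subseteq\mathcal P({}^NA)$ closed under subsets; a double suit is a pair of suits $\langle X^+,X^-\rangle$ with $X^+\cap X^-=\{\emptyset\}$; an IFG-algebra is double-suited if all its elements are double suits. A congruence is an equivalence relation preserved by all operations. An algebra is simple if its only congruences are the identity relation and the total relation, and hereditarily simple if all its subalgebras are simple. -}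

module Defs where

open import Level using (Level; _⊔_; suc; Lift; Setω)
open import Data.Nat using (ℕ)
open import Data.Fin using (Fin)
open import Data.Fin.Subset using (Subset; _∉_)
open import Data.Vec using (Vec; lookup; _[_]≔_)
open import Data.Product using (Σ; _×_; _,_)
open import Data.Sum using (_⊎_)
open import Data.Unit.Polymorphic using (⊤)
open import Data.Empty using (⊥)
open import Relation.Nullary using (¬_)
open import Relation.Binary.PropositionalEquality using (_≡_; _≢_)

-- Syntax: binary terms (variables X = var₀, Y = var₁) in the language of IFG_N-algebras.
data Term (N : ℕ) : Set where
  var₀ var₁ : Term N
  𝟘t 𝟙t : Term N
  Dt : Fin N → Fin N → Term N
  ¬t : Term N → Term N
  _+t[_]_ : Term N → Subset N → Term N → Term N
  _·t[_]_ : Term N → Subset N → Term N → Term N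
  Ct : Fin N → Subset N → Term N → Term N

module IFG {a : Level} (A : Set a) (N : ℕ) where

  -- valuations ^N A  (N identified with Fin N)
  Val : Set a
  Val = Vec A N

  Team : Set (suc a)
  Team = Val → Set a

  _⊆T_ : Team → Team → Set a
  V ⊆T W = ∀ x → V x → W x

  _≐T_ : Team → Team → Set a
  V ≐T W = (V ⊆T W) × (W ⊆T V)

  EmptyT : Team → Set a
  EmptyT V = ∀ x → ¬ V x

  _≈[_]_ : Val → Subset N → Val → Set a
  x ≈[ J ] y = ∀ i → i ∉ J → lookup x i ≡ lookup y i

  Split : Subset N → Team → Team → Team → Set a
  Split J V V₁ V₂ =
    ((V₁ ⊆T V) × (V₂ ⊆T V) × (∀ x → V x → V₁ x ⊎ V₂ x))
    × (∀ x → V₁ x → V₂ x → ⊥)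
    × (∀ x y → V y → x ≈[ J ] y → V₁ x → V₁ y)
    × (∀ x y → V y → x ≈[ J ] y → V₂ x → V₂ y)

  Indep : Subset N → (V : Team) → ((x : Val) → V x → A) → Set a
  Indep J V f = ∀ x y (p : V x) (q : V y) → x ≈[ J ] y → f x p ≡ f y q

  upd : (V : Team) → Fin N → ((x : Val) → V x → A) → Team
  upd V n f c = Σ Val λ x → Σ (V x) λ p → c ≡ x [ n ]≔ f x p

  updA : Team → Fin N → Team
  updA W n c = Σ Val λ x → Σ A λ b → W x × (c ≡ x [ n ]≔ b)

  record Elem : Set (suc (suc a)) where
    constructor ⟨_,_⟩
    field
      pos : Team → Set (suc a)
      neg : Team → Set (suc a)
  open Elem public

  -- genuine sets of teams: membership respects extensional equality of teams
  Ext : Elem → Set (suc a)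
  Ext X = ∀ V W → V ≐T W → (pos X V → pos X W) × (neg X V → neg X W)

  _≈E_ : Elem → Elem → Set (suc a)
  X ≈E Y = ∀ V → ((pos X V → pos Y V) × (pos Y V → pos X V))
                 × ((neg X V → neg Y V) × (neg Y V → neg X V))

  𝟘 : Elem
  𝟘 = ⟨ (λ V → Lift (suc a) (EmptyT V)) , (λ V → ⊤) ⟩

  𝟙 : Elem
  𝟙 = ⟨ (λ V → ⊤) , (λ V → Lift (suc a) (EmptyT V)) ⟩

  D : Fin N → Fin N → Elem
  D i j = ⟨ (λ V → Lift (suc a) (∀ x → V x → lookup x i ≡ lookup x j))
          , (λ V → Lift (suc a) (∀ x → V x → lookup x i ≢ lookup x j)) ⟩

  ¬E : Elem → Elem
  ¬E X = ⟨ neg X , pos X ⟩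

  _+[_]_ : Elem → Subset N → Elem → Elem
  X +[ J ] Y = ⟨ (λ V → Σ Team λ V₁ → Σ Team λ V₂ → Split J V V₁ V₂ × pos X V₁ × pos Y V₂)
               , (λ V → neg X V × neg Y V) ⟩

  _·[_]_ : Elem → Subset N → Elem → Elem
  X ·[ J ] Y = ⟨ (λ V → pos X V × pos Y V)
               , (λ W → Σ Team λ W₁ → Σ Team λ W₂ → Split J W W₁ W₂ × neg X W₁ × neg Y W₂) ⟩

  Cyl : Fin N → Subset N → Elem → Elem
  Cyl n J X = ⟨ (λ V → Σ ((x : Val) → V x → A) λ f → Indep J V f × pos X (upd V n f))
              , (λ W → neg X (updA W n)) ⟩

  eval : Term N → Elem → Elem → Elem
  eval var₀ X Y = X
  eval var₁ X Y = Y
  eval 𝟘t X Y = 𝟘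
  eval 𝟙t X Y = 𝟙
  eval (Dt i j) X Y = D i j
  eval (¬t t) X Y = ¬E (eval t X Y)
  eval (t +t[ J ] s) X Y = eval t X Y +[ J ] eval s X Y
  eval (t ·t[ J ] s) X Y = eval t X Y ·[ J ] eval s X Y
  eval (Ct n J t) X Y = Cyl n J (eval t X Y)

  Closed : ∀ {ℓ} → (Elem → Set ℓ) → Set (suc (suc a) ⊔ ℓ)
  Closed S = S 𝟘 × S 𝟙 × (∀ i j → S (D i j))
           × (∀ X → S X → S (¬E X))
           × (∀ J X Y → S X → S Y → S (X +[ J ] Y))
           × (∀ J X Y → S X → S Y → S (X ·[ J ] Y))
           × (∀ n J X → S X → S (Cyl n J X))

  -- an IFG_N-algebra (over A): a subalgebra of the power set algebra
  IsIFGAlgebra : ∀ {ℓ} → (Elem → Set ℓ) → Set (suc (suc a) ⊔ ℓ)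
  IsIFGAlgebra C = (∀ X → C X → Ext X) × Closed C

  Suit : (Team → Set (suc a)) → Set (suc a)
  Suit S = (Σ Team S) × (∀ V W → S V → W ⊆T V → S W)

  DoubleSuit : Elem → Set (suc a)
  DoubleSuit X = Suit (pos X) × Suit (neg X)
               × (∀ V → (pos X V × neg X V → EmptyT V) × (EmptyT V → pos X V × neg X V))

  DoubleSuited : ∀ {ℓ} → (Elem → Set ℓ) → Set (suc (suc a) ⊔ ℓ)
  DoubleSuited C = ∀ X → C X → DoubleSuit X

  -- congruences on a subalgebra B (equality of elements is ≈E)
  IsCongruence : ∀ {ℓ ℓ'} → (Elem → Set ℓ) → (Elem → Elem → Set ℓ') → Set (suc (suc a) ⊔ ℓ ⊔ ℓ')
  IsCongruence B θ =
      (∀ X Y → B X → B Y → X ≈E Y → θ X Y)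
    × (∀ X Y → B X → B Y → θ X Y → θ Y X)
    × (∀ X Y Z → B X → B Y → B Z → θ X Y → θ Y Z → θ X Z)
    × (∀ X X' → B X → B X' → θ X X' → θ (¬E X) (¬E X'))
    × (∀ J X X' Y Y' → B X → B X' → B Y → B Y' → θ X X' → θ Y Y'
         → θ (X +[ J ] Y) (X' +[ J ] Y'))
    × (∀ J X X' Y Y' → B X → B X' → B Y → B Y' → θ X X' → θ Y Y'
         → θ (X ·[ J ] Y) (X' ·[ J ] Y'))
    × (∀ n J X X' → B X → B X' → θ X X' → θ (Cyl n J X) (Cyl n J X'))

  Simple : ∀ {ℓ} → (Elem → Set ℓ) → Setω
  Simple B = ∀ {ℓ'} (θ : Elem → Elem → Set ℓ') → IsCongruence B θ →
      (∀ X Y → B X → B Y → θ X Y → X ≈E Y)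
    ⊎ (∀ X Y → B X → B Y → θ X Y)

  HereditarilySimple : ∀ {ℓ} → (Elem → Set ℓ) → Setω
  HereditarilySimple C = ∀ {ℓ'} (B : Elem → Set ℓ') → (∀ X → B X → C X) → Closed B → Simple B

module Submission where

-- Let B be a subalgebra of C and θ a congruence of B.  If θ
-- relates two distinct elements X, Y then, since T(X,X) = 𝟙 while
-- T(X,Y) ≠ 𝟙, θ also relates 𝟙 to some Z ≠ 𝟙, and then θ is total:
--   * the universal cylindrification Q = ¬C_{0,∅}¬ ⋯ ¬C_{N-1,∅}¬ sends 𝟙 to
--     an element equal to 𝟙, and (by downward closure of Z⁺) sends a double
--     suit Z ≠ 𝟙 to an element P whose positive part contains only the empty
--     team;
--   * hence 𝟙 θ P, and 𝟘 = 𝟙·¬𝟙 θ P·¬P = P, so 𝟙 θ 𝟘;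
--   * every U then satisfies U = U·𝟙 θ U·𝟘 = 𝟘, so θ is total.
-- Otherwise θ relates only equal elements; excluded middle decides which case
-- occurs.

open import Defs
open import Level using (Level; Lift; lift; lower)
open import Data.Nat using (ℕ)
open import Data.Product using (_×_; Σ; _,_; proj₁; proj₂)
open import Data.Sum using (_⊎_; inj₁; inj₂)
open import Data.Empty using (⊥; ⊥-elim)
open import Data.Fin using (Fin; _≟_)
open import Data.Fin.Subset using () renaming (⊥ to ∅)
open import Data.Vec using (lookup; _[_]≔_)
open import Data.Vec.Properties using (lookup∘update; lookup∘update′)
open import Data.Vec.Relation.Binary.Pointwise.Extensional using (ext; Pointwise-≡⇒≡)
open import Data.List using (List; []; _∷_; allFin)
open import Data.List.Membership.Propositional using (_∉_)
open import Data.List.Membership.Propositional.Properties using (∈-allFin)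
open import Data.List.Relation.Unary.Any using (here; there)
open import Relation.Nullary using (¬_; yes; no)
open import Relation.Binary.PropositionalEquality using (_≡_; refl; trans; subst)
open import Function.Bundles using (_⇔_; mk⇔; Equivalence)
open import Axiom.ExcludedMiddle using (ExcludedMiddle)

module PowerSetAlgebra {a : Level} (A : Set a) (N : ℕ) where
  open IFG A N

  ≈E-refl : ∀ X → X ≈E X
  ≈E-refl X V = ((λ p → p) , (λ p → p)) , ((λ n → n) , (λ n → n))

  ≈E-sym : ∀ X Y → X ≈E Y → Y ≈E X
  ≈E-sym X Y X≈Y V =
    (proj₂ (proj₁ (X≈Y V)) , proj₁ (proj₁ (X≈Y V))) ,
    (proj₂ (proj₂ (X≈Y V)) , proj₁ (proj₂ (X≈Y V)))

  full⇒≈𝟙 : ∀ X → DoubleSuit X → (∀ V → pos X V) → X ≈E 𝟙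
  full⇒≈𝟙 X (_ , _ , disjoint) full V =
    ((λ _ → _) , (λ _ → full V)) ,
    ((λ n → lift (proj₁ (disjoint V) (full V , n))) ,
     (λ e → proj₂ (proj₂ (disjoint V) (lower e))))

  ∅T : Team
  ∅T _ = Lift a ⊥

  ∅T-empty : EmptyT ∅T
  ∅T-empty _ ()

  split-∅ʳ : ∀ J W → Split J W W ∅T
  split-∅ʳ J W =
    ((λ _ w → w) , (λ _ ()) , (λ _ w → inj₁ w)) ,
    (λ _ _ ()) , (λ _ _ w _ _ → w) , (λ _ _ _ _ ())

  split-∅ˡ : ∀ J W → Split J W ∅T W
  split-∅ˡ J W =
    ((λ _ ()) , (λ _ w → w) , (λ _ w → inj₂ w)) ,
    (λ _ ()) , (λ _ _ _ _ ()) , (λ _ _ w _ _ → w)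

  split-emptyʳ : ∀ J W W₁ W₂ → Split J W W₁ W₂ → EmptyT W₂ → W ⊆T W₁
  split-emptyʳ J W W₁ W₂ ((_ , _ , cover) , _) W₂-empty x w with cover x w
  ... | inj₁ w₁ = w₁
  ... | inj₂ w₂ = ⊥-elim (W₂-empty x w₂)

  ·-absorb : ∀ J X Y → DoubleSuit X → (∀ V → pos X V → pos Y V) →
             (∀ V → neg Y V → EmptyT V) → neg Y ∅T → (X ·[ J ] Y) ≈E X
  ·-absorb J X Y (_ , (_ , neg-down) , _) X⁺⊆Y⁺ Y⁻-empty Y⁻∅ V =
    (proj₁ , (λ p → p , X⁺⊆Y⁺ V p)) ,
    ((λ { (W₁ , W₂ , split , n₁ , n₂) →
           neg-down W₁ V n₁ (split-emptyʳ J V W₁ W₂ split (Y⁻-empty W₂ n₂)) }) ,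
     (λ n → V , ∅T , split-∅ʳ J V , n , Y⁻∅))

  ·𝟙 : ∀ J X → DoubleSuit X → (X ·[ J ] 𝟙) ≈E X
  ·𝟙 J X dsX = ·-absorb J X 𝟙 dsX (λ _ _ → _) (λ _ → lower) (lift ∅T-empty)

  ·¬-idem : ∀ J X → DoubleSuit X → (∀ V → pos X V → EmptyT V) → (X ·[ J ] ¬E X) ≈E X
  ·¬-idem J X dsX@(_ , _ , disjoint) X⁺-empty =
    ·-absorb J X (¬E X) dsX (λ V p → proj₂ (proj₂ (disjoint V) (X⁺-empty V p)))
      X⁺-empty (proj₁ (proj₂ (disjoint ∅T) ∅T-empty))

  ·𝟘 : ∀ J X → DoubleSuit X → (X ·[ J ] 𝟘) ≈E 𝟘
  ·𝟘 J X (_ , _ , disjoint) V =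
    (proj₂ , (λ e → proj₁ (proj₂ (disjoint V) (lower e)) , e)) ,
    ((λ _ → _) , (λ _ → ∅T , V , split-∅ˡ J V , proj₂ (proj₂ (disjoint ∅T) ∅T-empty) , _))

  cylTeam : List (Fin N) → Team → Team
  cylTeam [] V = V
  cylTeam (i ∷ is) V = cylTeam is (updA V i)

  cylTeam-∋ : ∀ is V x c → V x → (∀ j → j ∉ is → lookup x j ≡ lookup c j) → cylTeam is V c
  cylTeam-∋ [] V x c v agree = subst V (Pointwise-≡⇒≡ (ext (λ j → agree j λ ()))) v
  cylTeam-∋ (i ∷ is) V x c v agree =
    cylTeam-∋ is (updA V i) (x [ i ]≔ lookup c i) c (x , lookup c i , v , refl) agree′
    where
    agree′ : ∀ j → j ∉ is → lookup (x [ i ]≔ lookup c i) j ≡ lookup c j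
    agree′ j j∉is with j ≟ i
    ... | yes refl = lookup∘update j x (lookup c j)
    ... | no j≢i = trans (lookup∘update′ j≢i x (lookup c i))
                         (agree j (λ { (here j≡i) → j≢i j≡i ; (there j∈is) → j∉is j∈is }))

  univCylTerm : List (Fin N) → Term N
  univCylTerm [] = var₀
  univCylTerm (i ∷ is) = ¬t (Ct i ∅ (¬t (univCylTerm is)))

  univCyl : List (Fin N) → Elem → Elem
  univCyl is X = eval (univCylTerm is) X X

  univCyl-pos : ∀ is X V → pos (univCyl is X) V ⇔ pos X (cylTeam is V)
  univCyl-pos [] X V = mk⇔ (λ p → p) (λ p → p)
  univCyl-pos (i ∷ is) X V = univCyl-pos is X (updA V i)

  allCoords : List (Fin N)
  allCoords = allFin N

  cylTeam-full : ∀ V x c → V x → cylTeam allCoords V c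
  cylTeam-full V x c v = cylTeam-∋ allCoords V x c v (λ j j∉all → ⊥-elim (j∉all (∈-allFin j)))

  univCyl-𝟙 : ∀ is → DoubleSuit (univCyl is 𝟙) → univCyl is 𝟙 ≈E 𝟙
  univCyl-𝟙 is ds = full⇒≈𝟙 (univCyl is 𝟙) ds (λ V → Equivalence.from (univCyl-pos is 𝟙 V) _)

  -- For a double suit Z ≠ 𝟙, the positive part of univCyl allCoords Z holds
  -- only empty teams: a nonempty one would put the full team, and by downward
  -- closure every team, into Z⁺.
  univCyl-≉𝟙 : ∀ Z → DoubleSuit Z → ¬ (Z ≈E 𝟙) → ∀ V → pos (univCyl allCoords Z) V → EmptyT V
  univCyl-≉𝟙 Z dsZ@((_ , pos-down) , _) Z≉𝟙 V p x v = Z≉𝟙 (full⇒≈𝟙 Z dsZ Z⁺-full)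
    where
    Z⁺-full : ∀ W → pos Z W
    Z⁺-full W = pos-down (cylTeam allCoords V) W (Equivalence.to (univCyl-pos allCoords Z V) p)
                         (λ c _ → cylTeam-full V x c v)

  module Congruence {ℓ ℓ'} (B : Elem → Set ℓ) (closed : Closed B)
                    (θ : Elem → Elem → Set ℓ') (congruence : IsCongruence B θ) where

    B𝟘 : B 𝟘
    B𝟘 = proj₁ closed

    B𝟙 : B 𝟙
    B𝟙 = proj₁ (proj₂ closed)

    B-D : ∀ i j → B (D i j)
    B-D = proj₁ (proj₂ (proj₂ closed))

    B-¬ : ∀ X → B X → B (¬E X)
    B-¬ = proj₁ (proj₂ (proj₂ (proj₂ closed)))

    B-+ : ∀ J X Y → B X → B Y → B (X +[ J ] Y)
    B-+ = proj₁ (proj₂ (proj₂ (proj₂ (proj₂ closed))))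

    B-· : ∀ J X Y → B X → B Y → B (X ·[ J ] Y)
    B-· = proj₁ (proj₂ (proj₂ (proj₂ (proj₂ (proj₂ closed)))))

    B-Cyl : ∀ n J X → B X → B (Cyl n J X)
    B-Cyl = proj₂ (proj₂ (proj₂ (proj₂ (proj₂ (proj₂ closed)))))

    θ-≈ : ∀ X Y → B X → B Y → X ≈E Y → θ X Y
    θ-≈ = proj₁ congruence

    θ-sym : ∀ X Y → B X → B Y → θ X Y → θ Y X
    θ-sym = proj₁ (proj₂ congruence)

    θ-trans : ∀ X Y Z → B X → B Y → B Z → θ X Y → θ Y Z → θ X Z
    θ-trans = proj₁ (proj₂ (proj₂ congruence))

    θ-¬ : ∀ X X' → B X → B X' → θ X X' → θ (¬E X) (¬E X')
    θ-¬ = proj₁ (proj₂ (proj₂ (proj₂ congruence)))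

    θ-+ : ∀ J X X' Y Y' → B X → B X' → B Y → B Y' → θ X X' → θ Y Y'
          → θ (X +[ J ] Y) (X' +[ J ] Y')
    θ-+ = proj₁ (proj₂ (proj₂ (proj₂ (proj₂ congruence))))

    θ-· : ∀ J X X' Y Y' → B X → B X' → B Y → B Y' → θ X X' → θ Y Y'
          → θ (X ·[ J ] Y) (X' ·[ J ] Y')
    θ-· = proj₁ (proj₂ (proj₂ (proj₂ (proj₂ (proj₂ congruence)))))

    θ-Cyl : ∀ n J X X' → B X → B X' → θ X X' → θ (Cyl n J X) (Cyl n J X')
    θ-Cyl = proj₂ (proj₂ (proj₂ (proj₂ (proj₂ (proj₂ congruence)))))

    θ-refl : ∀ X → B X → θ X X
    θ-refl X bX = θ-≈ X X bX bX (≈E-refl X)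

    θ-up-to-≈ : ∀ X X' Y' Y → B X → B X' → B Y' → B Y → X' ≈E X → θ X' Y' → Y' ≈E Y → θ X Y
    θ-up-to-≈ X X' Y' Y bX bX' bY' bY X'≈X X'θY' Y'≈Y =
      θ-trans X X' Y bX bX' bY (θ-≈ X X' bX bX' (≈E-sym X' X X'≈X))
        (θ-trans X' Y' Y bX' bY' bY X'θY' (θ-≈ Y' Y bY' bY Y'≈Y))

    eval-closed : ∀ T X Y → B X → B Y → B (eval T X Y)
    eval-closed var₀ X Y bX bY = bX
    eval-closed var₁ X Y bX bY = bY
    eval-closed 𝟘t X Y bX bY = B𝟘
    eval-closed 𝟙t X Y bX bY = B𝟙
    eval-closed (Dt i j) X Y bX bY = B-D i j
    eval-closed (¬t t) X Y bX bY = B-¬ _ (eval-closed t X Y bX bY)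
    eval-closed (t +t[ J ] s) X Y bX bY = B-+ J _ _ (eval-closed t X Y bX bY) (eval-closed s X Y bX bY)
    eval-closed (t ·t[ J ] s) X Y bX bY = B-· J _ _ (eval-closed t X Y bX bY) (eval-closed s X Y bX bY)
    eval-closed (Ct n J t) X Y bX bY = B-Cyl n J _ (eval-closed t X Y bX bY)

    eval-compat : ∀ T X Y X' Y' → B X → B Y → B X' → B Y' → θ X X' → θ Y Y'
                  → θ (eval T X Y) (eval T X' Y')
    eval-compat var₀ X Y X' Y' bX bY bX' bY' XθX' YθY' = XθX'
    eval-compat var₁ X Y X' Y' bX bY bX' bY' XθX' YθY' = YθY'
    eval-compat 𝟘t X Y X' Y' bX bY bX' bY' XθX' YθY' = θ-refl 𝟘 B𝟘
    eval-compat 𝟙t X Y X' Y' bX bY bX' bY' XθX' YθY' = θ-refl 𝟙 B𝟙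
    eval-compat (Dt i j) X Y X' Y' bX bY bX' bY' XθX' YθY' = θ-refl (D i j) (B-D i j)
    eval-compat (¬t t) X Y X' Y' bX bY bX' bY' XθX' YθY' =
      θ-¬ _ _ (eval-closed t X Y bX bY) (eval-closed t X' Y' bX' bY')
        (eval-compat t X Y X' Y' bX bY bX' bY' XθX' YθY')
    eval-compat (t +t[ J ] s) X Y X' Y' bX bY bX' bY' XθX' YθY' =
      θ-+ J _ _ _ _ (eval-closed t X Y bX bY) (eval-closed t X' Y' bX' bY')
        (eval-closed s X Y bX bY) (eval-closed s X' Y' bX' bY')
        (eval-compat t X Y X' Y' bX bY bX' bY' XθX' YθY')
        (eval-compat s X Y X' Y' bX bY bX' bY' XθX' YθY')
    eval-compat (t ·t[ J ] s) X Y X' Y' bX bY bX' bY' XθX' YθY' =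
      θ-· J _ _ _ _ (eval-closed t X Y bX bY) (eval-closed t X' Y' bX' bY')
        (eval-closed s X Y bX bY) (eval-closed s X' Y' bX' bY')
        (eval-compat t X Y X' Y' bX bY bX' bY' XθX' YθY')
        (eval-compat s X Y X' Y' bX bY bX' bY' XθX' YθY')
    eval-compat (Ct n J t) X Y X' Y' bX bY bX' bY' XθX' YθY' =
      θ-Cyl n J _ _ (eval-closed t X Y bX bY) (eval-closed t X' Y' bX' bY')
        (eval-compat t X Y X' Y' bX bY bX' bY' XθX' YθY')

    module _ (doubleSuited : ∀ X → B X → DoubleSuit X) where

      𝟙θZ⇒𝟙θ𝟘 : ∀ Z → B Z → ¬ (Z ≈E 𝟙) → θ 𝟙 Z → θ 𝟙 𝟘
      𝟙θZ⇒𝟙θ𝟘 Z bZ Z≉𝟙 𝟙θZ = θ-trans 𝟙 P 𝟘 B𝟙 bP B𝟘 𝟙θP (θ-sym 𝟘 P B𝟘 bP 𝟘θP)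
        where
        Q = univCylTerm allCoords
        P = univCyl allCoords Z
        bP : B P
        bP = eval-closed Q Z Z bZ bZ
        bQ𝟙 : B (univCyl allCoords 𝟙)
        bQ𝟙 = eval-closed Q 𝟙 𝟙 B𝟙 B𝟙
        -- 𝟙 = Q(𝟙) θ Q(Z) = P
        𝟙θP : θ 𝟙 P
        𝟙θP = θ-up-to-≈ 𝟙 (univCyl allCoords 𝟙) P P B𝟙 bQ𝟙 bP bP
                (univCyl-𝟙 allCoords (doubleSuited _ bQ𝟙))
                (eval-compat Q 𝟙 𝟙 Z Z B𝟙 B𝟙 bZ bZ 𝟙θZ 𝟙θZ) (≈E-refl P)
        -- 𝟘 = 𝟙·¬𝟙 θ P·¬P = P, the last step because P⁺ ⊆ {∅}
        𝟘θP : θ 𝟘 P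
        𝟘θP = θ-up-to-≈ 𝟘 (𝟙 ·[ ∅ ] 𝟘) (P ·[ ∅ ] ¬E P) P B𝟘 (B-· ∅ 𝟙 𝟘 B𝟙 B𝟘)
                (B-· ∅ P (¬E P) bP (B-¬ P bP)) bP
                (·𝟘 ∅ 𝟙 (doubleSuited 𝟙 B𝟙))
                (θ-· ∅ 𝟙 P 𝟘 (¬E P) B𝟙 bP B𝟘 (B-¬ P bP) 𝟙θP (θ-¬ 𝟙 P B𝟙 bP 𝟙θP))
                (·¬-idem ∅ P (doubleSuited P bP) (univCyl-≉𝟙 Z (doubleSuited Z bZ) Z≉𝟙))

      -- ... and a congruence relating 𝟙 to 𝟘 is total: U = U·𝟙 θ U·𝟘 = 𝟘.
      𝟙θ𝟘⇒total : θ 𝟙 𝟘 → ∀ U W → B U → B W → θ U W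
      𝟙θ𝟘⇒total 𝟙θ𝟘 U W bU bW = θ-trans U 𝟘 W bU B𝟘 bW (θ𝟘 U bU) (θ-sym W 𝟘 bW B𝟘 (θ𝟘 W bW))
        where
        θ𝟘 : ∀ U → B U → θ U 𝟘
        θ𝟘 U bU = θ-up-to-≈ U (U ·[ ∅ ] 𝟙) (U ·[ ∅ ] 𝟘) 𝟘 bU (B-· ∅ U 𝟙 bU B𝟙) (B-· ∅ U 𝟘 bU B𝟘) B𝟘
                    (·𝟙 ∅ U (doubleSuited U bU))
                    (θ-· ∅ U U 𝟙 𝟘 bU bU B𝟙 B𝟘 (θ-refl U bU) 𝟙θ𝟘)
                    (·𝟘 ∅ U (doubleSuited U bU))

      -- With a term T such that T(X,Y) = 𝟙 exactly when X = Y, a congruence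
      -- relating two distinct elements X, Y relates 𝟙 = T(X,X) to T(X,Y) ≠ 𝟙.
      module _ (T : Term N)
               (T-eq : ∀ X Y → B X → B Y → ((eval T X Y ≈E 𝟙 → X ≈E Y) × (X ≈E Y → eval T X Y ≈E 𝟙)))
               where

        distinct⇒total : ∀ X Y → B X → B Y → θ X Y → ¬ (X ≈E Y) → ∀ U W → B U → B W → θ U W
        distinct⇒total X Y bX bY XθY X≉Y = 𝟙θ𝟘⇒total (𝟙θZ⇒𝟙θ𝟘 (eval T X Y) bTXY TXY≉𝟙 𝟙θTXY)
          where
          bTXY : B (eval T X Y)
          bTXY = eval-closed T X Y bX bY
          TXY≉𝟙 : ¬ (eval T X Y ≈E 𝟙)
          TXY≉𝟙 TXY≈𝟙 = X≉Y (proj₁ (T-eq X Y bX bY) TXY≈𝟙)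
          𝟙θTXY : θ 𝟙 (eval T X Y)
          𝟙θTXY = θ-up-to-≈ 𝟙 (eval T X X) (eval T X Y) (eval T X Y)
                    B𝟙 (eval-closed T X X bX bX) bTXY bTXY
                    (proj₂ (T-eq X X bX bX) (≈E-refl X))
                    (eval-compat T X X X Y bX bX bX bY (θ-refl X bX) XθY)
                    (≈E-refl (eval T X Y))

        identity-or-total : (∀ {k} → ExcludedMiddle k) →
          (∀ X Y → B X → B Y → θ X Y → X ≈E Y) ⊎ (∀ X Y → B X → B Y → θ X Y)
        identity-or-total em
          with em {P = Σ Elem λ X → Σ Elem λ Y → B X × B Y × θ X Y × ¬ (X ≈E Y)}
        ... | yes (X , Y , bX , bY , XθY , X≉Y) = inj₂ (distinct⇒total X Y bX bY XθY X≉Y)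
        ... | no no-distinct = inj₁ identity
          where
          identity : ∀ X Y → B X → B Y → θ X Y → X ≈E Y
          identity X Y bX bY XθY with em {P = X ≈E Y}
          ... | yes X≈Y = X≈Y
          ... | no X≉Y = ⊥-elim (no-distinct (X , Y , bX , bY , XθY , X≉Y))

-- Theorem 7.  A double-suited IFG-algebra in which equality is expressed by a
-- term T (T(X,Y) = 𝟙 iff X = Y) is hereditarily simple: every subalgebra
-- inherits both properties, so each of its congruences is identity or total.
mainTheorem7 : ∀ {a ℓ : Level} → (∀ {ℓ'} → ExcludedMiddle ℓ') →
    (A : Set a) (N : ℕ) →
    let open IFG A N in
    (C : Elem → Set ℓ) → IsIFGAlgebra C → DoubleSuited C →
    (T : Term N) →
    (∀ X Y → C X → C Y → ((eval T X Y ≈E 𝟙 → X ≈E Y) × (X ≈E Y → eval T X Y ≈E 𝟙))) →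
    HereditarilySimple C
mainTheorem7 em A N C _ C-doubleSuited T T-eq B B⊆C B-closed θ θ-congruence =
  identity-or-total (λ X bX → C-doubleSuited X (B⊆C X bX)) T
    (λ X Y bX bY → T-eq X Y (B⊆C X bX) (B⊆C Y bY)) em
  where open PowerSetAlgebra A N
        open Congruence B B-closed θ θ-congruence
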